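{- Let $\mu\in(1,2)$ be a rational number given as an irreducible fraction $\mu=c/d$. Then $|I_k|\ge\frac{1}{2d^k}$ for every integer $k\ge2$.
   Context: The tent map $f=f_\mu$ on $[0,1]$ is $f(x)=\mu x$ for $x\le1/2$, $f(x)=\mu(1-x)$ for $x\ge1/2$; $f^i$ is the $i$-fold iterate. The tent code $\gamma^m(z)=b_1\cdots b_m$ is defined by $b_1=0$ if $z<1/2$, $b_1=1$ if $z\ge1/2$, and for $j\ge1$, with $z_j=f^j(z)$: $b_{j+1}=b_j$ if $z_j<1/2$, $b_{j+1}=\overline{b_j}$ if $z_j>1/2$, $b_{j+1}=1$ if $z_j=1/2$. For a code $\mathbf{b}$ of length $m$, $T(\mathbf{b})=\{f^m(z): z\in[0,1),\ \gamma^m(z)=\mathbf{b}\}$ (an interval). $I_k=T(\gamma^k(1/2))$ and $|I_k|$ denotes its length. -}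

module Defs where

open import Data.Bool using (Bool; true; false; not; if_then_else_)
open import Data.Nat using (ℕ; zero; suc)
open import Data.List using (List; []; _∷_)
open import Data.Integer using (+_)
open import Data.Rational using (ℚ; _+_; _*_; _-_; _/_; ½; 1ℚ; 0ℚ; _<_; _≤_)
open import Data.Rational.Properties using (_<?_; _≟_)
open import Relation.Nullary using (does)

tent : ℚ → ℚ → ℚ
tent μ x = if does (x <? ½) then μ * x else μ * (1ℚ - x)

iter : (ℚ → ℚ) → ℕ → ℚ → ℚ
iter f zero x = x
iter f (suc n) x = iter f n (f x)

firstBit : ℚ → Bool
firstBit z = if does (z <? ½) then false else true

nextBit : Bool → ℚ → Bool
nextBit b z = if does (z ≟ ½) then true else (if does (z <? ½) then b else not b)

-- codeFrom μ n b x, where b = b_j and x = z_j, outputs b_j, …, b_{j+n-1}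
codeFrom : ℚ → ℕ → Bool → ℚ → List Bool
codeFrom μ zero b x = []
codeFrom μ (suc n) b x = b ∷ codeFrom μ n (nextBit b x) (tent μ x)

-- tent code γ^m(z) = b₁ ⋯ b_m  (with z₁ = f(z))
γ : ℚ → ℕ → ℚ → List Bool
γ μ m z = codeFrom μ m (firstBit z) (tent μ z)

qpow : ℚ → ℕ → ℚ
qpow q zero = 1ℚ
qpow q (suc n) = q * qpow q n

-- "the interval T(b) for b = γ^k(1/2), i.e. I_k, has length ≥ L":
-- for every rational ε > 0 there are z₁ z₂ ∈ [0,1) with code γ^k(1/2)
-- whose images under f^k differ by more than L - ε.
IkLengthAtLeast : ℚ → ℕ → ℚ → Set
IkLengthAtLeast μ k L =
  (ε : ℚ) → 0ℚ < ε →
  Σ ℚ λ z₁ → Σ ℚ λ z₂ →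
    (0ℚ ≤ z₁) × (z₁ < 1ℚ) × (0ℚ ≤ z₂) × (z₂ < 1ℚ) ×
    (γ μ k z₁ ≡ γ μ k ½) × (γ μ k z₂ ≡ γ μ k ½) ×
    (L - ε < iter (tent μ) k z₁ - iter (tent μ) k z₂)
  where
  open import Data.Product using (Σ; _×_)
  open import Relation.Binary.PropositionalEquality using (_≡_)

{-# OPTIONS --safe #-}

-- Write μ = c/d in lowest terms and cⱼ = fʲ(½). Since μ and 1 are integer
-- multiples of 1/d, the tent map sends hℤ into (h/d)ℤ as long as ½ ∈ hℤ;
-- hence ½ and cⱼ both lie on (½d⁻ʲ)ℤ, so either cⱼ = ½ or |cⱼ − ½| ≥ ½d⁻ʲ.
-- For small t > 0 the orbit of z = ½ + t therefore shadows that of ½,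
-- fʲ(z) = cⱼ ∓ μʲt, without ever crossing ½ except when cⱼ = ½ itself, and
-- the code of z agrees with γᵏ(½). Taking μᵏt just below ½d⁻ᵏ gives two points
-- of Iₖ, fᵏ(½) and fᵏ(z), at distance μᵏt.

module Submission where

open import Defs
open import Data.Bool.Base using (Bool; true; false; not)
open import Data.List.Base using (_∷_)
open import Data.List.Properties using (∷-injectiveʳ)
open import Data.Nat.Base as ℕ using (ℕ; zero; suc; _≤′_; ≤′-refl; ≤′-step; z<s; s<s)
import Data.Nat.Properties as ℕ
import Data.Nat.Coprimality as Coprimality
open import Data.Integer.Base as ℤ using (ℤ; +_)
import Data.Integer.Properties as ℤ
open import Data.Rational.Base
open import Data.Rational.Properties
open import Data.Rational.Solver using (module +-*-Solver)
import Data.Rational.Unnormalised.Base as ℚᵘ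
import Data.Rational.Unnormalised.Properties as ℚᵘ
open import Data.Product.Base using (Σ; _×_; _,_)
open import Function.Base using (_$_)
open import Data.Sum.Base using (inj₁; inj₂)
open import Relation.Binary.Definitions using (tri<; tri≈; tri>)
open import Relation.Binary.PropositionalEquality
open import Relation.Nullary.Decidable using (yes; no; dec-true; dec-false)

fromℤ : ℤ → ℚ
fromℤ p = mkℚ p 0 (Coprimality.sym (Coprimality.1-coprimeTo _))

fromℤ-+ : ∀ p q → fromℤ (p ℤ.+ q) ≡ fromℤ p + fromℤ q
fromℤ-+ p q =
  toℚᵘ-injective (ℚᵘ.≃-sym (ℚᵘ.≃-trans (toℚᵘ-homo-+ (fromℤ p) (fromℤ q)) (ℚᵘ.*≡* eq)))
  where
  eq : (p ℤ.* + 1 ℤ.+ q ℤ.* + 1) ℤ.* + 1 ≡ (p ℤ.+ q) ℤ.* + 1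
  eq = cong (ℤ._* + 1) (cong₂ ℤ._+_ (ℤ.*-identityʳ p) (ℤ.*-identityʳ q))

fromℤ-* : ∀ p q → fromℤ (p ℤ.* q) ≡ fromℤ p * fromℤ q
fromℤ-* p q = toℚᵘ-injective (ℚᵘ.≃-sym (toℚᵘ-homo-* (fromℤ p) (fromℤ q)))

fromℤ-neg : ∀ p → fromℤ (ℤ.- p) ≡ - fromℤ p
fromℤ-neg p = toℚᵘ-injective (ℚᵘ.≃-sym (toℚᵘ-homo‿- (fromℤ p)))

fromℤ-mono-≤ : ∀ {p q} → p ℤ.≤ q → fromℤ p ≤ fromℤ q
fromℤ-mono-≤ {p} {q} p≤q = *≤* (subst₂ ℤ._≤_ (sym (ℤ.*-identityʳ p)) (sym (ℤ.*-identityʳ q)) p≤q)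

p/n≡p*1/n : ∀ p n .{{_ : ℕ.NonZero n}} → p / n ≡ fromℤ p * (+ 1 / n)
p/n≡p*1/n p (suc n) = toℚᵘ-injective (begin
  toℚᵘ (p / suc n)                          ≈⟨ toℚᵘ-fromℚᵘ (ℚᵘ.mkℚᵘ p n) ⟩
  ℚᵘ.mkℚᵘ p n                               ≈⟨ ℚᵘ.*≡* numerators ⟨
  ℚᵘ.mkℚᵘ p 0 ℚᵘ.* ℚᵘ.mkℚᵘ (+ 1) n          ≈⟨ ℚᵘ.*-congˡ {ℚᵘ.mkℚᵘ p 0} (toℚᵘ-fromℚᵘ (ℚᵘ.mkℚᵘ (+ 1) n)) ⟨
  toℚᵘ (fromℤ p) ℚᵘ.* toℚᵘ (+ 1 / suc n)    ≈⟨ toℚᵘ-homo-* (fromℤ p) (+ 1 / suc n) ⟨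
  toℚᵘ (fromℤ p * (+ 1 / suc n))            ∎)
  where
  open ℚᵘ.≃-Reasoning
  numerators : (p ℤ.* + 1) ℤ.* + suc n ≡ p ℤ.* + suc (n ℕ.+ 0)
  numerators = cong₂ ℤ._*_ (ℤ.*-identityʳ p) (cong (λ m → + suc m) (sym (ℕ.+-identityʳ n)))

n/n≡1 : ∀ n .{{_ : ℕ.NonZero n}} → + n / n ≡ 1ℚ
n/n≡1 (suc n) =
  toℚᵘ-injective (ℚᵘ.≃-trans (toℚᵘ-fromℚᵘ (ℚᵘ.mkℚᵘ (+ suc n) n)) (ℚᵘ.*≡* (ℤ.*-comm (+ suc n) (+ 1))))

p<p+q : ∀ p {q} → 0ℚ < q → p < p + q
p<p+q p {q} 0<q = subst (_< p + q) (+-identityʳ p) (+-monoʳ-< p 0<q)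

p-q<p : ∀ p {q} → 0ℚ < q → p - q < p
p-q<p p {q} 0<q = subst (p - q <_) (+-identityʳ p) (+-monoʳ-< p (neg-antimono-< 0<q))

*-pos : ∀ {p q} → 0ℚ < p → 0ℚ < q → 0ℚ < p * q
*-pos {p} {q} 0<p 0<q = positive⁻¹ (p * q) {{pos*pos⇒pos p {{positive 0<p}} q {{positive 0<q}}}}

0≤½ : 0ℚ ≤ ½
0≤½ = <⇒≤ (positive⁻¹ ½)

½<1 : ½ < 1ℚ
½<1 = p<p+q ½ (positive⁻¹ ½)

∃-between : ∀ {L ε} → 0ℚ < L → 0ℚ < ε → Σ ℚ λ u → 0ℚ < u × u < L × L - ε < u
∃-between {L} {ε} 0<L 0<ε with ≤-total 0ℚ (L - ε)
... | inj₁ 0≤L-ε = let u , L-ε<u , u<L = <-dense (p-q<p L 0<ε)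
                   in u , ≤-<-trans 0≤L-ε L-ε<u , u<L , L-ε<u
... | inj₂ L-ε≤0 = let u , 0<u , u<L = <-dense 0<L
                   in u , 0<u , u<L , ≤-<-trans L-ε≤0 0<u

1/n≤1 : ∀ n .{{_ : ℕ.NonZero n}} → + 1 / n ≤ 1ℚ
1/n≤1 n = begin
  + 1 / n                      ≡⟨ *-identityʳ (+ 1 / n) ⟨
  + 1 / n * 1ℚ                 ≤⟨ *-monoˡ-≤-nonNeg (+ 1 / n) {{normalize-nonNeg 1 n}} 1≤n ⟩
  + 1 / n * fromℤ (+ n)        ≡⟨ *-comm (+ 1 / n) (fromℤ (+ n)) ⟩
  fromℤ (+ n) * (+ 1 / n)      ≡⟨ p/n≡p*1/n (+ n) n ⟨
  + n / n                      ≡⟨ n/n≡1 n ⟩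
  1ℚ                           ∎
  where
  open ≤-Reasoning
  1≤n : 1ℚ ≤ fromℤ (+ n)
  1≤n = fromℤ-mono-≤ (ℤ.+≤+ (ℕ.>-nonZero⁻¹ n))

0<1/n : ∀ n .{{_ : ℕ.NonZero n}} → 0ℚ < + 1 / n
0<1/n n = positive⁻¹ (+ 1 / n) {{normalize-pos 1 n}}

qpow-pos : ∀ {a} → 0ℚ < a → ∀ n → 0ℚ < qpow a n
qpow-pos 0<a zero = positive⁻¹ 1ℚ
qpow-pos 0<a (suc n) = *-pos 0<a (qpow-pos 0<a n)

0<½*qpow : ∀ {a} → 0ℚ < a → ∀ j → 0ℚ < ½ * qpow a j
0<½*qpow 0<a j = *-pos (positive⁻¹ ½) (qpow-pos 0<a j)

qpow-monoʳ-≤ : ∀ {a} → 1ℚ ≤ a → ∀ {m n} → m ℕ.≤ n → qpow a m ≤ qpow a n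
qpow-monoʳ-≤ {a} 1≤a {m} m≤n = go (ℕ.≤⇒≤′ m≤n)
  where
  0<a : 0ℚ < a
  0<a = <-≤-trans (positive⁻¹ 1ℚ) 1≤a
  go : ∀ {n} → m ≤′ n → qpow a m ≤ qpow a n
  go ≤′-refl = ≤-refl
  go {suc n} (≤′-step m≤n) = ≤-trans (go m≤n) (subst (_≤ a * qpow a n) (*-identityˡ (qpow a n))
    (*-monoʳ-≤-nonNeg (qpow a n) {{nonNegative (<⇒≤ (qpow-pos 0<a n))}} 1≤a))

qpow-antimonoʳ-≤ : ∀ {a} → 0ℚ < a → a ≤ 1ℚ → ∀ {m n} → m ℕ.≤ n → qpow a n ≤ qpow a m
qpow-antimonoʳ-≤ {a} 0<a a≤1 {m} m≤n = go (ℕ.≤⇒≤′ m≤n)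
  where
  go : ∀ {n} → m ≤′ n → qpow a n ≤ qpow a m
  go ≤′-refl = ≤-refl
  go {suc n} (≤′-step m≤n) = ≤-trans (subst (a * qpow a n ≤_) (*-identityˡ (qpow a n))
    (*-monoʳ-≤-nonNeg (qpow a n) {{nonNegative (<⇒≤ (qpow-pos 0<a n))}} a≤1)) (go m≤n)

module _ (μ : ℚ) where

  tent-< : ∀ {x} → x < ½ → tent μ x ≡ μ * x
  tent-< {x} x<½ rewrite dec-true (x <? ½) x<½ = refl

  tent-≥ : ∀ {x} → ½ ≤ x → tent μ x ≡ μ * (1ℚ - x)
  tent-≥ {x} ½≤x rewrite dec-false (x <? ½) (λ x<½ → <-irrefl refl (≤-<-trans ½≤x x<½)) = refl

nextBit-< : ∀ b {x} → x < ½ → nextBit b x ≡ b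
nextBit-< b {x} x<½ rewrite dec-false (x ≟ ½) (<⇒≢ x<½) | dec-true (x <? ½) x<½ = refl

nextBit-> : ∀ b {x} → ½ < x → nextBit b x ≡ not b
nextBit-> b {x} ½<x rewrite dec-false (x ≟ ½) (≢-sym (<⇒≢ ½<x)) | dec-false (x <? ½) (<-asym ½<x) = refl

firstBit≡nextBit-false : ∀ z → firstBit z ≡ nextBit false z
firstBit≡nextBit-false z with z ≟ ½
... | yes refl = refl
... | no _ = refl

data OnGrid (h x : ℚ) : Set where
  multiple : ∀ P → x ≡ fromℤ P * h → OnGrid h x

onGrid-+ : ∀ {h x y} → OnGrid h x → OnGrid h y → OnGrid h (x + y)
onGrid-+ {h} (multiple P refl) (multiple Q refl) =
  multiple (P ℤ.+ Q) $ sym (trans (cong (_* h) (fromℤ-+ P Q)) (*-distribʳ-+ h (fromℤ P) (fromℤ Q)))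

onGrid-neg : ∀ {h x} → OnGrid h x → OnGrid h (- x)
onGrid-neg {h} (multiple P refl) =
  multiple (ℤ.- P) $ trans (neg-distribˡ-* (fromℤ P) h) (cong (_* h) (sym (fromℤ-neg P)))

onGrid-* : ∀ {h h′ x y} → OnGrid h x → OnGrid h′ y → OnGrid (h * h′) (x * y)
onGrid-* {h} {h′} (multiple P refl) (multiple Q refl) = multiple (P ℤ.* Q) (begin
  fromℤ P * h * (fromℤ Q * h′)      ≡⟨ solve 4 (λ p h q h′ → (p :* h) :* (q :* h′) := (p :* q) :* (h :* h′))
                                               refl (fromℤ P) h (fromℤ Q) h′ ⟩
  fromℤ P * fromℤ Q * (h * h′)      ≡⟨ cong (_* (h * h′)) (fromℤ-* P Q) ⟨
  fromℤ (P ℤ.* Q) * (h * h′)        ∎)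
  where open ≡-Reasoning; open +-*-Solver

onGrid-/ : ∀ p n .{{_ : ℕ.NonZero n}} → OnGrid (+ 1 / n) (p / n)
onGrid-/ p n = multiple p (p/n≡p*1/n p n)

grid-gap : ∀ {h P Q} → 0ℚ ≤ h → P ℤ.< Q → fromℤ P * h + h ≤ fromℤ Q * h
grid-gap {h} {P} {Q} 0≤h P<Q = begin
  fromℤ P * h + h              ≡⟨ +-comm (fromℤ P * h) h ⟩
  h + fromℤ P * h              ≡⟨ cong (_+ fromℤ P * h) (*-identityˡ h) ⟨
  1ℚ * h + fromℤ P * h         ≡⟨ *-distribʳ-+ h 1ℚ (fromℤ P) ⟨
  (1ℚ + fromℤ P) * h           ≡⟨ cong (_* h) (fromℤ-+ (+ 1) P) ⟨
  fromℤ (ℤ.suc P) * h          ≤⟨ *-monoʳ-≤-nonNeg h {{nonNegative 0≤h}} (fromℤ-mono-≤ (ℤ.i<j⇒suc[i]≤j P<Q)) ⟩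
  fromℤ Q * h                  ∎
  where open ≤-Reasoning

data Avoids½ (δ : ℚ) : ℚ → Set where
  at½   : Avoids½ δ ½
  below : ∀ {x} → x + δ < ½ → Avoids½ δ x
  above : ∀ {x} → ½ + δ < x → Avoids½ δ x

onGrid⇒avoids½ : ∀ {h δ x} → 0ℚ < h → OnGrid h ½ → OnGrid h x → δ < h → Avoids½ δ x
onGrid⇒avoids½ {h} {δ} 0<h (multiple Q ½≡Qh) (multiple P refl) δ<h with ℤ.<-cmp P Q
... | tri≈ _ refl _ = subst (Avoids½ δ) ½≡Qh at½
... | tri< P<Q _ _ = below (begin-strict
  fromℤ P * h + δ    <⟨ +-monoʳ-< (fromℤ P * h) δ<h ⟩
  fromℤ P * h + h    ≤⟨ grid-gap (<⇒≤ 0<h) P<Q ⟩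
  fromℤ Q * h        ≡⟨ ½≡Qh ⟨
  ½                  ∎)
  where open ≤-Reasoning
... | tri> _ _ Q<P = above (begin-strict
  ½ + δ              ≡⟨ cong (_+ δ) ½≡Qh ⟩
  fromℤ Q * h + δ    <⟨ +-monoʳ-< (fromℤ Q * h) δ<h ⟩
  fromℤ Q * h + h    ≤⟨ grid-gap (<⇒≤ 0<h) Q<P ⟩
  fromℤ P * h        ∎)
  where open ≤-Reasoning

module _ (μ : ℚ) {g : ℚ} (μ∈gℤ : OnGrid g μ) (1∈gℤ : OnGrid g 1ℚ) where

  tent-onGrid : ∀ {h x} → OnGrid h ½ → OnGrid h x → OnGrid (g * h) ½ × OnGrid (g * h) (tent μ x)
  tent-onGrid {h} {x} ½∈hℤ x∈hℤ = subst (OnGrid (g * h)) (*-identityˡ ½) (onGrid-* 1∈gℤ ½∈hℤ) , tentx∈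
    where
    tentx∈ : OnGrid (g * h) (tent μ x)
    tentx∈ with x <? ½
    ... | yes x<½ = subst (OnGrid (g * h)) (sym (tent-< μ x<½)) (onGrid-* μ∈gℤ x∈hℤ)
    -- 1 = ½ + ½ lies on hℤ because ½ does.
    ... | no x≮½  = subst (OnGrid (g * h)) (sym (tent-≥ μ (≮⇒≥ x≮½)))
                      (onGrid-* μ∈gℤ (onGrid-+ (onGrid-+ ½∈hℤ ½∈hℤ) (onGrid-neg x∈hℤ)))

  iter-onGrid : ∀ {h x} → OnGrid h ½ → OnGrid h x →
                ∀ j → OnGrid (h * qpow g j) ½ × OnGrid (h * qpow g j) (iter (tent μ) j x)
  iter-onGrid {h} ½∈hℤ x∈hℤ zero rewrite *-identityʳ h = ½∈hℤ , x∈hℤ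
  iter-onGrid {h} {x} ½∈hℤ x∈hℤ (suc j) =
    let ½∈ghℤ , tentx∈ghℤ = tent-onGrid ½∈hℤ x∈hℤ
    in subst (λ s → OnGrid s ½ × OnGrid s (iter (tent μ) (suc j) x)) spacing
             (iter-onGrid ½∈ghℤ tentx∈ghℤ j)
    where
    spacing : g * h * qpow g j ≡ h * qpow g (suc j)
    spacing = solve 3 (λ h g q → g :* h :* q := h :* (g :* q)) refl h g (qpow g j)
      where open +-*-Solver

-- The displacement fʲ(z) − cⱼ is negative exactly when the current code bit
-- is 1. So when cⱼ = ½, fʲ(z) lies on the side of ½ whose next bit is 1,
-- which is also the bit the code rule assigns to ½ itself.
offset : Bool → ℚ → ℚ → ℚ
offset true  x δ = x - δ
offset false x δ = x + δ

module _ where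
  open +-*-Solver

  *-offset : ∀ μ b x δ → μ * offset b x δ ≡ offset b (μ * x) (μ * δ)
  *-offset μ true  = solve 3 (λ μ x δ → μ :* (x :- δ) := μ :* x :- μ :* δ) refl μ
  *-offset μ false = solve 3 (λ μ x δ → μ :* (x :+ δ) := μ :* x :+ μ :* δ) refl μ

  1-offset : ∀ b x δ → 1ℚ - offset b x δ ≡ offset (not b) (1ℚ - x) δ
  1-offset true  = solve 2 (λ x δ → con 1ℚ :- (x :- δ) := con 1ℚ :- x :+ δ) refl
  1-offset false = solve 2 (λ x δ → con 1ℚ :- (x :+ δ) := con 1ℚ :- x :- δ) refl

  offset-false-gap : ∀ y δ → offset false y δ - y ≡ δ
  offset-false-gap = solve 2 (λ y δ → y :+ δ :- y := δ) refl

  offset-true-gap : ∀ y δ → y - offset true y δ ≡ δ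
  offset-true-gap = solve 2 (λ y δ → y :- (y :- δ) := δ) refl

offset-< : ∀ b {x δ a} → 0ℚ < δ → x + δ < a → offset b x δ < a
offset-< true  {x} 0<δ x+δ<a = <-trans (<-trans (p-q<p x 0<δ) (p<p+q x 0<δ)) x+δ<a
offset-< false     0<δ x+δ<a = x+δ<a

offset-> : ∀ b {x δ a} → 0ℚ < δ → a + δ < x → a < offset b x δ
offset-> true  {x} {δ} {a} 0<δ a+δ<x = subst (_< x - δ) a+δ-δ≡a (+-monoˡ-< (- δ) a+δ<x)
  where
  a+δ-δ≡a : a + δ - δ ≡ a
  a+δ-δ≡a = trans (+-assoc a δ (- δ)) (trans (cong (λ q → a + q) (+-inverseʳ δ)) (+-identityʳ a))
offset-> false {x} {δ} {a} 0<δ a+δ<x = <-trans (p<p+q a 0<δ) (<-trans a+δ<x (p<p+q x 0<δ))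

module _ (μ : ℚ) where

  tent-offset : ∀ b {x δ} → 0ℚ < δ → Avoids½ δ x →
                nextBit b (offset b x δ) ≡ nextBit b x ×
                tent μ (offset b x δ) ≡ offset (nextBit b x) (tent μ x) (μ * δ)
  tent-offset true {δ = δ} 0<δ at½ = nextBit-< true ½-δ<½ , (begin
    tent μ (½ - δ)                ≡⟨ tent-< μ ½-δ<½ ⟩
    μ * (½ - δ)                   ≡⟨ *-offset μ true ½ δ ⟩
    μ * ½ - μ * δ                 ∎)
    where
    open ≡-Reasoning
    ½-δ<½ : ½ - δ < ½
    ½-δ<½ = p-q<p ½ 0<δ
  tent-offset false {δ = δ} 0<δ at½ = nextBit-> false ½<½+δ , (begin
    tent μ (½ + δ)                ≡⟨ tent-≥ μ (<⇒≤ ½<½+δ) ⟩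
    μ * (1ℚ - (½ + δ))            ≡⟨ cong (μ *_) (1-offset false ½ δ) ⟩
    μ * (½ - δ)                   ≡⟨ *-offset μ true ½ δ ⟩
    μ * ½ - μ * δ                 ∎)
    where
    open ≡-Reasoning
    ½<½+δ : ½ < ½ + δ
    ½<½+δ = p<p+q ½ 0<δ
  tent-offset b {x} {δ} 0<δ (below x+δ<½) =
    trans (nextBit-< b x′<½) (sym (nextBit-< b x<½)) , (begin
    tent μ (offset b x δ)                     ≡⟨ tent-< μ x′<½ ⟩
    μ * offset b x δ                          ≡⟨ *-offset μ b x δ ⟩
    offset b (μ * x) (μ * δ)                  ≡⟨ cong₂ (λ b′ y → offset b′ y (μ * δ))
                                                         (nextBit-< b x<½) (tent-< μ x<½) ⟨
    offset (nextBit b x) (tent μ x) (μ * δ)   ∎)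
    where
    open ≡-Reasoning
    x<½ : x < ½
    x<½ = <-trans (p<p+q x 0<δ) x+δ<½
    x′<½ : offset b x δ < ½
    x′<½ = offset-< b 0<δ x+δ<½
  tent-offset b {x} {δ} 0<δ (above ½+δ<x) =
    trans (nextBit-> b ½<x′) (sym (nextBit-> b ½<x)) , (begin
    tent μ (offset b x δ)                     ≡⟨ tent-≥ μ (<⇒≤ ½<x′) ⟩
    μ * (1ℚ - offset b x δ)                   ≡⟨ cong (μ *_) (1-offset b x δ) ⟩
    μ * offset (not b) (1ℚ - x) δ             ≡⟨ *-offset μ (not b) (1ℚ - x) δ ⟩
    offset (not b) (μ * (1ℚ - x)) (μ * δ)     ≡⟨ cong₂ (λ b′ y → offset b′ y (μ * δ))
                                                         (nextBit-> b ½<x) (tent-≥ μ (<⇒≤ ½<x)) ⟨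
    offset (nextBit b x) (tent μ x) (μ * δ)   ∎)
    where
    open ≡-Reasoning
    ½<x : ½ < x
    ½<x = <-trans (p<p+q ½ 0<δ) ½+δ<x
    ½<x′ : ½ < offset b x δ
    ½<x′ = offset-> b 0<δ ½+δ<x

  codeFrom-offset : 0ℚ < μ → ∀ n b {x δ} → 0ℚ < δ →
    (∀ i → i ℕ.< n → Avoids½ (qpow μ i * δ) (iter (tent μ) i x)) →
    codeFrom μ (suc n) b (offset b x δ) ≡ codeFrom μ (suc n) b x ×
    Σ Bool λ b′ → iter (tent μ) n (offset b x δ) ≡ offset b′ (iter (tent μ) n x) (qpow μ n * δ)
  codeFrom-offset 0<μ zero b {x} {δ} 0<δ avoids = refl , b , cong (offset b x) (sym (*-identityˡ δ))
  codeFrom-offset 0<μ (suc n) b {x} {δ} 0<δ avoids =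
    let nextBit≡ , tent≡ = tent-offset b 0<δ (subst (λ e → Avoids½ e x) (*-identityˡ δ) (avoids 0 z<s))
        codes≡ , b′ , iter≡ = codeFrom-offset 0<μ n (nextBit b x) (*-pos 0<μ 0<δ)
          (λ i i<n → subst (λ e → Avoids½ e (iter (tent μ) i (tent μ x)))
                            (qpow-suc-* i) (avoids (suc i) (s<s i<n)))
    in cong (b ∷_) (trans (cong₂ (codeFrom μ (suc n)) nextBit≡ tent≡) codes≡) ,
       b′ , trans (cong (iter (tent μ) n) tent≡) (trans iter≡ (cong (offset b′ _) (sym (qpow-suc-* n))))
    where
    qpow-suc-* : ∀ i → qpow μ (suc i) * δ ≡ qpow μ i * (μ * δ)
    qpow-suc-* i = solve 3 (λ μ q δ → μ :* q :* δ := q :* (μ :* δ)) refl μ (qpow μ i) δ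
      where open +-*-Solver

false∷γ≡codeFrom-false : ∀ μ k z → false ∷ γ μ k z ≡ codeFrom μ (suc k) false z
false∷γ≡codeFrom-false μ k z = cong (λ b → false ∷ codeFrom μ k b (tent μ z)) (firstBit≡nextBit-false z)

module _ (μ : ℚ) where

  orbit½-avoids½ : ∀ {δ} j → δ < ½ * qpow (+ 1 / ↧ₙ μ) j → Avoids½ δ (iter (tent μ) j ½)
  orbit½-avoids½ j δ<h =
    let ½∈hℤ , cⱼ∈hℤ = iter-onGrid μ μ∈rℤ 1∈rℤ (multiple (+ 1) refl) (multiple (+ 1) refl) j
    in onGrid⇒avoids½ (0<½*qpow (0<1/n (↧ₙ μ)) j) ½∈hℤ cⱼ∈hℤ δ<h
    where
    r : ℚ
    r = + 1 / ↧ₙ μ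
    μ∈rℤ : OnGrid r μ
    μ∈rℤ = subst (OnGrid r) (↥p/↧p≡p μ) (onGrid-/ (↥ μ) (↧ₙ μ))
    1∈rℤ : OnGrid r 1ℚ
    1∈rℤ = subst (OnGrid r) (n/n≡1 (↧ₙ μ)) (onGrid-/ (+ ↧ₙ μ) (↧ₙ μ))

IkContainsGap : ℚ → ℕ → ℚ → Set
IkContainsGap μ k δ = Σ ℚ λ z₁ → Σ ℚ λ z₂ →
  (0ℚ ≤ z₁) × (z₁ < 1ℚ) × (0ℚ ≤ z₂) × (z₂ < 1ℚ) ×
  (γ μ k z₁ ≡ γ μ k ½) × (γ μ k z₂ ≡ γ μ k ½) ×
  (iter (tent μ) k z₁ - iter (tent μ) k z₂ ≡ δ)

ikLengthAtLeast-intro : ∀ {μ k L} → 0ℚ < L → (∀ {u} → 0ℚ < u → u < L → IkContainsGap μ k u) →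
                        IkLengthAtLeast μ k L
ikLengthAtLeast-intro {L = L} 0<L gaps ε 0<ε =
  let u , 0<u , u<L , L-ε<u = ∃-between 0<L 0<ε
      z₁ , z₂ , 0≤z₁ , z₁<1 , 0≤z₂ , z₂<1 , γz₁ , γz₂ , gap = gaps 0<u u<L
  in z₁ , z₂ , 0≤z₁ , z₁<1 , 0≤z₂ , z₂<1 , γz₁ , γz₂ , subst (L - ε <_) (sym gap) L-ε<u

ikContainsGap-offset : ∀ μ k b {z u} → 0ℚ ≤ z → z < 1ℚ → γ μ k z ≡ γ μ k ½ →
                       iter (tent μ) k z ≡ offset b (iter (tent μ) k ½) u → IkContainsGap μ k u
ikContainsGap-offset μ k false 0≤z z<1 γz≡γ½ fᵏz≡ =
  _ , ½ , 0≤z , z<1 , 0≤½ , ½<1 , γz≡γ½ , refl ,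
  trans (cong (_- iter (tent μ) k ½) fᵏz≡) (offset-false-gap (iter (tent μ) k ½) _)
ikContainsGap-offset μ k true  0≤z z<1 γz≡γ½ fᵏz≡ =
  ½ , _ , 0≤½ , ½<1 , 0≤z , z<1 , refl , γz≡γ½ ,
  trans (cong (λ y → iter (tent μ) k ½ - y) fᵏz≡) (offset-true-gap (iter (tent μ) k ½) _)

ikContainsGap : ∀ μ → 1ℚ ≤ μ → ∀ k {u} → 0ℚ < u → u < ½ * qpow (+ 1 / ↧ₙ μ) k → IkContainsGap μ k u
ikContainsGap μ 1≤μ k {u} 0<u u<Lₖ =
  let codes≡ , b , fᵏz≡ = codeFrom-offset μ 0<μ k false 0<t avoids
  in ikContainsGap-offset μ k b 0≤z z<1 (γz≡γ½ codes≡) (trans fᵏz≡ (cong (offset b _) μᵏt≡u))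
  where
  r : ℚ
  r = + 1 / ↧ₙ μ
  L : ℕ → ℚ
  L j = ½ * qpow r j
  0<μ : 0ℚ < μ
  0<μ = <-≤-trans (positive⁻¹ 1ℚ) 1≤μ
  instance
    μᵏ≢0 : NonZero (qpow μ k)
    μᵏ≢0 = pos⇒nonZero (qpow μ k) {{positive (qpow-pos 0<μ k)}}
  t : ℚ
  t = u * 1/ qpow μ k
  0<t : 0ℚ < t
  0<t = *-pos 0<u (positive⁻¹ (1/ qpow μ k) {{1/pos⇒pos (qpow μ k) {{positive (qpow-pos 0<μ k)}}}})
  μᵏt≡u : qpow μ k * t ≡ u
  μᵏt≡u = trans (solve 3 (λ q u w → q :* (u :* w) := u :* (q :* w)) refl (qpow μ k) u (1/ qpow μ k))
                (trans (cong (u *_) (*-inverseʳ (qpow μ k))) (*-identityʳ u))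
    where open +-*-Solver
  μⁱt<Lᵢ : ∀ {i} → i ℕ.≤ k → qpow μ i * t < L i
  μⁱt<Lᵢ {i} i≤k = begin-strict
    qpow μ i * t   ≤⟨ *-monoʳ-≤-nonNeg t {{nonNegative (<⇒≤ 0<t)}} (qpow-monoʳ-≤ 1≤μ i≤k) ⟩
    qpow μ k * t   ≡⟨ μᵏt≡u ⟩
    u              <⟨ u<Lₖ ⟩
    L k            ≤⟨ *-monoˡ-≤-nonNeg ½ (qpow-antimonoʳ-≤ (0<1/n (↧ₙ μ)) (1/n≤1 (↧ₙ μ)) i≤k) ⟩
    L i            ∎
    where open ≤-Reasoning
  avoids : ∀ i → i ℕ.< k → Avoids½ (qpow μ i * t) (iter (tent μ) i ½)
  avoids i i<k = orbit½-avoids½ μ i (μⁱt<Lᵢ (ℕ.<⇒≤ i<k))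
  z : ℚ
  z = ½ + t
  0≤z : 0ℚ ≤ z
  0≤z = ≤-trans 0≤½ (<⇒≤ (p<p+q ½ 0<t))
  z<1 : z < 1ℚ
  z<1 = +-monoʳ-< ½ (subst₂ _<_ (*-identityˡ t) (*-identityʳ ½) (μⁱt<Lᵢ ℕ.z≤n))
  γz≡γ½ : codeFrom μ (suc k) false z ≡ codeFrom μ (suc k) false ½ → γ μ k z ≡ γ μ k ½
  γz≡γ½ codes≡ = ∷-injectiveʳ (begin
    false ∷ γ μ k z                  ≡⟨ false∷γ≡codeFrom-false μ k z ⟩
    codeFrom μ (suc k) false z       ≡⟨ codes≡ ⟩
    codeFrom μ (suc k) false ½       ≡⟨ false∷γ≡codeFrom-false μ k ½ ⟨
    false ∷ γ μ k ½                  ∎)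
    where open ≡-Reasoning

Iₖ-length-≥ : ∀ μ → 1ℚ ≤ μ → ∀ k → IkLengthAtLeast μ k (½ * qpow (+ 1 / ↧ₙ μ) k)
Iₖ-length-≥ μ 1≤μ k = ikLengthAtLeast-intro (0<½*qpow (0<1/n (↧ₙ μ)) k) (ikContainsGap μ 1≤μ k)

lemma16 : (μ : ℚ) → 1ℚ < μ → μ < + 2 / 1 →
    (k : ℕ) → 2 ℕ.≤ k →
    IkLengthAtLeast μ k (½ * qpow (+ 1 / (↧ₙ μ)) k)
lemma16 μ 1<μ _ k _ = Iₖ-length-≥ μ (<⇒≤ 1<μ) k
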